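{- Let $\mathcal{M}$ be the set of Motzkin meanders that contain neither $UU$ nor $DD$ as a contiguous subword, and let $S(u)=\sum_{w\in\mathcal{M}} z^{|w|}u^{\mathrm{level}(w)}$. Put $$W=\sqrt{(1-z^4)(1-2z-z^2)},\qquad r_1=\frac{1-z-z^2-z^3-W}{2z^2}.$$ Then $$S(u)=\frac{(1+zu)r_1}{z^2(1-ur_1)},$$ and for every $j\ge1$ the generating function of the meanders in $\mathcal{M}$ ending at level $j$ is $[u^j]S(u)=\frac{r_1^{j+1}}{z^2}+\frac{r_1^{j}}{z}$.
   Context: A Motzkin meander is a finite word $w$ over $\{U,H,D\}$ (heights $+1,0,-1$) all of whose prefixes have nonnegative height sum; $|w|$ is its length and $\mathrm{level}(w)$ its total height sum; the empty word is included; excursions are meanders of level $0$. "Contains $XY$ as a contiguous subword" means two consecutive letters are $X$ then $Y$. Generating functions are formal power series in $z$; $W$ is the formal power series square root with constant term $1$; $[u^j]$ is coefficient extraction. -}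

module Defs where

open import Data.Nat as ℕ using (ℕ; zero; suc; _∸_)
open import Data.Integer as ℤ using (ℤ; +_)
open import Data.Rational as ℚ using (ℚ; 0ℚ; 1ℚ)
open import Data.List using (List; []; _∷_; inits; map; concatMap; filter; length; foldr; upTo)
open import Data.List.Relation.Unary.All using (All; all?)
open import Data.List.Relation.Binary.Infix.Heterogeneous using (Infix)
open import Data.List.Relation.Binary.Infix.Heterogeneous.Properties using (infix?)
open import Relation.Binary.PropositionalEquality using (_≡_; refl)
open import Relation.Nullary using (Dec; yes; no; ¬_)
open import Relation.Nullary.Decidable using (¬?; _×-dec_)
open import Data.Product using (_×_)

data Letter : Set where
  U H D : Letter

_≟L_ : (x y : Letter) → Dec (x ≡ y)
U ≟L U = yes refl
U ≟L H = no λ ()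
U ≟L D = no λ ()
H ≟L U = no λ ()
H ≟L H = yes refl
H ≟L D = no λ ()
D ≟L U = no λ ()
D ≟L H = no λ ()
D ≟L D = yes refl

height : Letter → ℤ
height U = + 1
height H = + 0
height D = ℤ.- (+ 1)

level : List Letter → ℤ
level = foldr (λ x s → height x ℤ.+ s) (+ 0)

IsMeander : List Letter → Set
IsMeander w = All (λ p → + 0 ℤ.≤ level p) (inits w)

Contains : Letter → Letter → List Letter → Set
Contains X Y w = Infix _≡_ (X ∷ Y ∷ []) w

InM : ℕ → List Letter → Set
InM j w = IsMeander w × (¬ Contains U U w) × (¬ Contains D D w) × (level w ≡ + j)

inM? : ∀ j w → Dec (InM j w)
inM? j w = all? (λ p → + 0 ℤ.≤? level p) (inits w)
  ×-dec ¬? (infix? _≟L_ (U ∷ U ∷ []) w)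
  ×-dec ¬? (infix? _≟L_ (D ∷ D ∷ []) w)
  ×-dec (level w ℤ.≟ + j)

words : ℕ → List (List Letter)
words zero = [] ∷ []
words (suc n) = concatMap (λ w → (U ∷ w) ∷ (H ∷ w) ∷ (D ∷ w) ∷ []) (words n)

count : ℕ → ℕ → ℕ
count n j = length (filter (inM? j) (words n))

-- Formal power series in z over ℚ: coefficient functions

PS : Set
PS = ℕ → ℚ

_≈_ : PS → PS → Set
f ≈ g = ∀ n → f n ≡ g n
infix 4 _≈_

fromℕℚ : ℕ → ℚ
fromℕℚ n = (+ n) ℚ./ 1

const : ℚ → PS
const c zero = c
const c (suc n) = 0ℚ

one : PS
one = const 1ℚ

Z : PS
Z (suc zero) = 1ℚ
Z _ = 0ℚ

_⊕_ : PS → PS → PS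
(f ⊕ g) n = f n ℚ.+ g n

_⊖_ : PS → PS → PS
(f ⊖ g) n = f n ℚ.- g n

_⊛_ : PS → PS → PS
(f ⊛ g) n = foldr (λ i s → f i ℚ.* g (n ∸ i) ℚ.+ s) 0ℚ (upTo (suc n))

infixl 6 _⊕_ _⊖_
infixl 7 _⊛_

_^ᶠ_ : PS → ℕ → PS
f ^ᶠ zero = one
f ^ᶠ suc k = f ⊛ (f ^ᶠ k)

infixr 8 _^ᶠ_

two : PS
two = const (fromℕℚ 2)

Wsq : PS
Wsq = (one ⊖ Z ^ᶠ 4) ⊛ (one ⊖ two ⊛ Z ⊖ Z ^ᶠ 2)

IsW : PS → Set
IsW W = (W 0 ≡ 1ℚ) × (W ⊛ W ≈ Wsq)

-- r₁ = (1 - z - z² - z³ - W) / (2 z²), i.e. 2 z² r₁ = 1 - z - z² - z³ - W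
IsR1 : PS → PS → Set
IsR1 W r₁ = two ⊛ Z ^ᶠ 2 ⊛ r₁ ≈ one ⊖ Z ⊖ Z ^ᶠ 2 ⊖ Z ^ᶠ 3 ⊖ W

-- Bivariate series in z,u: coefficient of u^j is a series in z

BS : Set
BS = ℕ → PS

_≈B_ : BS → BS → Set
F ≈B G = ∀ j → F j ≈ G j
infix 4 _≈B_

ι : PS → BS
ι f zero = f
ι f (suc j) = λ _ → 0ℚ

Uv : BS
Uv (suc zero) = one
Uv _ = λ _ → 0ℚ

_⊕B_ : BS → BS → BS
(F ⊕B G) j = F j ⊕ G j

_⊖B_ : BS → BS → BS
(F ⊖B G) j = F j ⊖ G j

_⊛B_ : BS → BS → BS
(F ⊛B G) j = λ n → foldr (λ i s → (F i ⊛ G (j ∸ i)) n ℚ.+ s) 0ℚ (upTo (suc j))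

infixl 6 _⊕B_ _⊖B_
infixl 7 _⊛B_

S : BS
S j n = fromℕℚ (count n j)

-- A word lies in 𝓜 iff it is accepted by the automaton whose live states record the current
-- height and the last letter. Hence the series F l j counting the words that end at level j with
-- last letter l satisfy F l j = [l = H, j = 0] + z Σ F l′ j′, summed over the one-step
-- predecessors (l′ , j′), and this system has exactly one solution. Writing r₁ = z² s, the
-- equation defining r₁ becomes s = 1 + z s + r₁ + z r₁ + r₁², and with it one checks that
-- F U (j + 1) = z s r₁^j, F H j = r₁^j (1 + z s) and F D j = r₁^(j+1) (1 + z + r₁) solve the
-- system. Summing over l and multiplying by z² gives z² [u^j] S = r₁ for j = 0 and
-- r₁^(j+1) + z r₁^j for j ≥ 1, and the functional equation for S follows coefficientwise in u.
-- Suitable W and r₁ exist because s ↦ 1 + z s + z² s + z³ s + z⁴ s² is a contraction on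
-- power series.

module Submission where

open import Defs
open import Data.Nat as ℕ using (ℕ; zero; suc; _≥_; _∸_; _<_; z≤n; s≤s; _≡ᵇ_)
import Data.Nat.Properties as ℕP
open import Algebra.Properties.CommutativeSemigroup ℕP.+-commutativeSemigroup
  using () renaming (interchange to +-interchange)
open import Data.Rational as ℚ using (ℚ; 0ℚ; 1ℚ)
open import Data.Integer as ℤ using (+_)
import Data.Integer.Properties as ℤP
import Data.Rational.Properties as ℚP
import Data.Nat.Coprimality as Coprime
import Data.Rational.Solver as ℚ-Solver
import Data.Nat.Solver as ℕ-Solver
open import Data.List using (List; []; _∷_; foldr; foldl; map; upTo; inits; length; filter; concatMap; _∷ʳ_)
open import Data.Nat.ListAction using (sum)
open import Data.List.Relation.Unary.All as All using (All; []; _∷_)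
import Data.List.Relation.Unary.All.Properties as AllP
open import Data.List.Relation.Binary.Infix.Heterogeneous using (here; there)
open import Data.List.Relation.Binary.Prefix.Heterogeneous using ([]; _∷_)
open import Data.Bool using (Bool; true; false; _∧_; if_then_else_; T)
open import Data.Empty using (⊥-elim)
open import Data.List.Properties using (foldr-map; foldl-∷ʳ; map-upTo; map-cong)
open import Data.Product using (Σ; _×_; _,_)
open import Data.Sum using (inj₁; inj₂)
open import Data.Maybe using (Maybe; just; nothing)
open import Relation.Nullary using (¬_; Dec; yes; no; does)
open import Relation.Nullary.Decidable using (dec-true; dec-false)
open import Relation.Unary using (Decidable)
open import Function.Bundles using (_⇔_; mk⇔; Equivalence)
open import Data.Unit using (tt)
import Function.Properties.Equivalence as ⇔
open import Relation.Binary.PropositionalEquality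
open import Function using (_∘_)
open import Algebra.Bundles using (CommutativeRing)
import Relation.Binary.Reasoning.Setoid as ≈-Reasoning
open import Algebra.Structures {A = PS} _≈_ using (IsCommutativeRing)
open import Algebra.Solver.Ring.AlmostCommutativeRing
  using (AlmostCommutativeRing; fromCommutativeRing; _-Raw-AlmostCommutative⟶_)
import Algebra.Solver.Ring
open import Level using (0ℓ)

-- An automaton recognising 𝓜

-- live k l: at height k with last letter l.
data State : Set where
  dead : State
  live : ℕ → Letter → State

-- The H clause comes first so that the case tree splits on the input letter before the last letter of the state.
step : State → Letter → State
step dead               _ = dead
step (live k _)         H = live k H
step (live k U)         U = dead
step (live k _)         U = live (suc k) U
step (live k D)         D = dead
step (live zero _)      D = dead
step (live (suc k) _)   D = live k D

run : State → List Letter → State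
run = foldl step

run-dead : ∀ w → run dead w ≡ dead
run-dead []      = refl
run-dead (_ ∷ w) = run-dead w

-- Before the first letter we are at height 0 after a virtual H, which forbids nothing.
start : State
start = live 0 H

accepts : ℕ → State → Bool
accepts j dead       = false
accepts j (live k _) = k ≡ᵇ j

ValidFrom : ℕ → Letter → ℕ → List Letter → Set
ValidFrom k l j w = All (λ p → + 0 ℤ.≤ + k ℤ.+ level p) (inits w)
                  × ¬ Contains U U (l ∷ w) × ¬ Contains D D (l ∷ w) × + k ℤ.+ level w ≡ + j

¬Contains-[] : ∀ {X Y l} → ¬ Contains X Y (l ∷ [])
¬Contains-[] (here (_ ∷ ()))
¬Contains-[] (there (here ()))

¬Contains-∷ : ∀ {X Y a w} → a ≢ X → ¬ Contains X Y w → ¬ Contains X Y (a ∷ w)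
¬Contains-∷ a≢X _    (here (X≡a ∷ _)) = a≢X (sym X≡a)
¬Contains-∷ _   ¬XYw (there XYw)      = ¬XYw XYw

¬Contains-∷∷ : ∀ {X Y a b w} → ¬ (a ≡ X × b ≡ Y) → ¬ Contains X Y (b ∷ w) → ¬ Contains X Y (a ∷ b ∷ w)
¬Contains-∷∷ ¬ab≡XY _     (here (refl ∷ refl ∷ _)) = ¬ab≡XY (refl , refl)
¬Contains-∷∷ _      ¬XYbw (there XYbw)             = ¬XYbw XYbw

0≤+k+0 : ∀ k → + 0 ℤ.≤ + k ℤ.+ + 0
0≤+k+0 k = subst (+ 0 ℤ.≤_) (sym (ℤP.+-identityʳ (+ k))) (ℤ.+≤+ z≤n)

InM⇔ValidFrom-start : ∀ j w → InM j w ⇔ ValidFrom 0 H j w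
InM⇔ValidFrom-start j w = mk⇔
  (λ (meander , ¬UU , ¬DD , lev) → All.map (subst (+ 0 ℤ.≤_) (sym (ℤP.+-identityˡ _))) meander
                                   , ¬Contains-∷ (λ ()) ¬UU , ¬Contains-∷ (λ ()) ¬DD , trans (ℤP.+-identityˡ (level w)) lev)
  (λ (meander , ¬UU , ¬DD , lev) → All.map (subst (+ 0 ℤ.≤_) (ℤP.+-identityˡ _)) meander
                                   , ¬UU ∘ there , ¬DD ∘ there , trans (sym (ℤP.+-identityˡ (level w))) lev)

ValidFrom-∷ : ∀ {k k′ l x j w} → + k ℤ.+ height x ≡ + k′ → ¬ (l ≡ U × x ≡ U) → ¬ (l ≡ D × x ≡ D)
            → ValidFrom k l j (x ∷ w) ⇔ ValidFrom k′ x j w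
ValidFrom-∷ {k} {k′} {l} {x} {j} {w} k+x≡k′ ¬UU ¬DD = mk⇔
  (λ { (_ ∷ nonneg , ¬UUw , ¬DDw , lev) → All.map (λ {p} → subst (+ 0 ℤ.≤_) (shift (level p))) (AllP.map⁻ nonneg)
                                         , ¬UUw ∘ there , ¬DDw ∘ there , trans (sym (shift (level w))) lev })
  (λ (nonneg , ¬UUw , ¬DDw , lev) → 0≤+k+0 k ∷ AllP.map⁺ (All.map (λ {p} → subst (+ 0 ℤ.≤_) (sym (shift (level p)))) nonneg)
                                   , ¬Contains-∷∷ ¬UU ¬UUw , ¬Contains-∷∷ ¬DD ¬DDw , trans (shift (level w)) lev)
  where
  shift : ∀ L → + k ℤ.+ (height x ℤ.+ L) ≡ + k′ ℤ.+ L
  shift L = trans (sym (ℤP.+-assoc (+ k) (height x) L)) (cong (ℤ._+ L) k+x≡k′)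

up : ∀ k → + k ℤ.+ height U ≡ + suc k
up k = cong +_ (ℕP.+-comm k 1)

rejected : ∀ {A : Set} {j} w → ¬ A → A ⇔ T (accepts j (run dead w))
rejected {j = j} w ¬A = mk⇔ (⊥-elim ∘ ¬A) (λ t → ⊥-elim (subst (T ∘ accepts j) (run-dead w) t))

ValidFrom⇔accepts : ∀ k l j w → ValidFrom k l j w ⇔ T (accepts j (run (live k l) w))
ValidFrom⇔accepts k l j [] = mk⇔
  (λ (_ , _ , _ , k+0≡j) → ℕP.≡⇒≡ᵇ k j (ℤP.+-injective (trans (sym (ℤP.+-identityʳ (+ k))) k+0≡j)))
  (λ k≡ᵇj → 0≤+k+0 k ∷ [] , ¬Contains-[] , ¬Contains-[] , trans (ℤP.+-identityʳ (+ k)) (cong +_ (ℕP.≡ᵇ⇒≡ k j k≡ᵇj)))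
ValidFrom⇔accepts k U j (U ∷ w) = rejected w (λ (_ , ¬UU , _) → ¬UU (here (refl ∷ refl ∷ [])))
ValidFrom⇔accepts k H j (U ∷ w) =
  ⇔.trans (ValidFrom-∷ (up k) (λ { (() , _) }) (λ { (() , _) })) (ValidFrom⇔accepts (suc k) U j w)
ValidFrom⇔accepts k D j (U ∷ w) =
  ⇔.trans (ValidFrom-∷ (up k) (λ { (() , _) }) (λ { (_ , ()) })) (ValidFrom⇔accepts (suc k) U j w)
ValidFrom⇔accepts k l j (H ∷ w) =
  ⇔.trans (ValidFrom-∷ (ℤP.+-identityʳ (+ k)) (λ { (_ , ()) }) (λ { (_ , ()) })) (ValidFrom⇔accepts k H j w)
ValidFrom⇔accepts k D j (D ∷ w) = rejected w (λ (_ , _ , ¬DD , _) → ¬DD (here (refl ∷ refl ∷ [])))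
ValidFrom⇔accepts zero U j (D ∷ w) = rejected w (λ { (_ ∷ () ∷ _ , _) })
ValidFrom⇔accepts zero H j (D ∷ w) = rejected w (λ { (_ ∷ () ∷ _ , _) })
ValidFrom⇔accepts (suc k) U j (D ∷ w) =
  ⇔.trans (ValidFrom-∷ refl (λ { (_ , ()) }) (λ { (() , _) })) (ValidFrom⇔accepts k D j w)
ValidFrom⇔accepts (suc k) H j (D ∷ w) =
  ⇔.trans (ValidFrom-∷ refl (λ { (() , _) }) (λ { (() , _) })) (ValidFrom⇔accepts k D j w)

𝟙 : Bool → ℕ
𝟙 b = if b then 1 else 0

module _ {A : Set} where

  sum-map-cong : ∀ {F G : A → ℕ} → (∀ x → F x ≡ G x) → ∀ xs → sum (map F xs) ≡ sum (map G xs)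
  sum-map-cong F≗G xs = cong sum (map-cong F≗G xs)

  sum-map-0 : ∀ (xs : List A) → sum (map (λ _ → 0) xs) ≡ 0
  sum-map-0 []       = refl
  sum-map-0 (_ ∷ xs) = sum-map-0 xs

  sum-map-+ : ∀ (F G : A → ℕ) xs → sum (map (λ x → F x ℕ.+ G x) xs) ≡ sum (map F xs) ℕ.+ sum (map G xs)
  sum-map-+ F G []       = refl
  sum-map-+ F G (x ∷ xs) = begin
    F x ℕ.+ G x ℕ.+ sum (map (λ x → F x ℕ.+ G x) xs)        ≡⟨ cong (F x ℕ.+ G x ℕ.+_) (sum-map-+ F G xs) ⟩
    F x ℕ.+ G x ℕ.+ (sum (map F xs) ℕ.+ sum (map G xs))     ≡⟨ +-interchange (F x) (G x) _ _ ⟩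
    F x ℕ.+ sum (map F xs) ℕ.+ (G x ℕ.+ sum (map G xs))     ∎
    where open ≡-Reasoning

  sum-map-sum : ∀ {B : Set} (F : A → B → ℕ) (ys : List B) xs
              → sum (map (λ x → sum (map (F x) ys)) xs) ≡ sum (map (λ y → sum (map (λ x → F x y) xs)) ys)
  sum-map-sum F []       xs = sum-map-0 xs
  sum-map-sum F (y ∷ ys) xs = trans (sum-map-+ (λ x → F x y) (λ x → sum (map (F x) ys)) xs)
                                    (cong (sum (map (λ x → F x y) xs) ℕ.+_) (sum-map-sum F ys xs))

  length-filter : ∀ {P : A → Set} (P? : Decidable P) xs → length (filter P? xs) ≡ sum (map (𝟙 ∘ does ∘ P?) xs)
  length-filter P? []       = refl
  length-filter P? (x ∷ xs) with does (P? x)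
  ... | true  = cong suc (length-filter P? xs)
  ... | false = length-filter P? xs

Σʷ : ℕ → (List Letter → ℕ) → ℕ
Σʷ n F = sum (map F (words n))

Σʷ-prepend : ∀ n F → Σʷ (suc n) F ≡ Σʷ n (F ∘ (U ∷_)) ℕ.+ Σʷ n (F ∘ (H ∷_)) ℕ.+ Σʷ n (F ∘ (D ∷_))
Σʷ-prepend n F = go (words n)
  where
  open ℕ-Solver.+-*-Solver
  go : ∀ ws → sum (map F (concatMap (λ w → (U ∷ w) ∷ (H ∷ w) ∷ (D ∷ w) ∷ []) ws))
            ≡ sum (map (F ∘ (U ∷_)) ws) ℕ.+ sum (map (F ∘ (H ∷_)) ws) ℕ.+ sum (map (F ∘ (D ∷_)) ws)
  go []       = refl
  go (w ∷ ws) = trans (cong (λ t → F (U ∷ w) ℕ.+ (F (H ∷ w) ℕ.+ (F (D ∷ w) ℕ.+ t))) (go ws))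
    (solve 6 (λ a b c x y z → a :+ (b :+ (c :+ (x :+ y :+ z))) := (a :+ x) :+ (b :+ y) :+ (c :+ z))
           refl (F (U ∷ w)) (F (H ∷ w)) (F (D ∷ w)) _ _ _)

Σʷ-append : ∀ n F → Σʷ (suc n) F ≡ Σʷ n (F ∘ (_∷ʳ U)) ℕ.+ Σʷ n (F ∘ (_∷ʳ H)) ℕ.+ Σʷ n (F ∘ (_∷ʳ D))
Σʷ-append zero F =
  solve 3 (λ a b c → a :+ (b :+ (c :+ con 0)) := (a :+ con 0) :+ (b :+ con 0) :+ (c :+ con 0))
        refl (F (U ∷ [])) (F (H ∷ [])) (F (D ∷ []))
  where open ℕ-Solver.+-*-Solver
Σʷ-append (suc n) F = begin
  Σʷ (suc (suc n)) F
    ≡⟨ Σʷ-prepend (suc n) F ⟩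
  Σʷ (suc n) (F ∘ (U ∷_)) ℕ.+ Σʷ (suc n) (F ∘ (H ∷_)) ℕ.+ Σʷ (suc n) (F ∘ (D ∷_))
    ≡⟨ cong₂ ℕ._+_ (cong₂ ℕ._+_ (Σʷ-append n (F ∘ (U ∷_))) (Σʷ-append n (F ∘ (H ∷_)))) (Σʷ-append n (F ∘ (D ∷_))) ⟩
  (g U U ℕ.+ g U H ℕ.+ g U D) ℕ.+ (g H U ℕ.+ g H H ℕ.+ g H D) ℕ.+ (g D U ℕ.+ g D H ℕ.+ g D D)
    ≡⟨ solve 9 (λ a b c d e f g h i → (a :+ b :+ c) :+ (d :+ e :+ f) :+ (g :+ h :+ i)
                                   := (a :+ d :+ g) :+ (b :+ e :+ h) :+ (c :+ f :+ i))
             refl (g U U) (g U H) (g U D) (g H U) (g H H) (g H D) (g D U) (g D H) (g D D) ⟩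
  (g U U ℕ.+ g H U ℕ.+ g D U) ℕ.+ (g U H ℕ.+ g H H ℕ.+ g D H) ℕ.+ (g U D ℕ.+ g H D ℕ.+ g D D)
    ≡⟨ sym (cong₂ ℕ._+_ (cong₂ ℕ._+_ (Σʷ-prepend n (F ∘ (_∷ʳ U))) (Σʷ-prepend n (F ∘ (_∷ʳ H)))) (Σʷ-prepend n (F ∘ (_∷ʳ D)))) ⟩
  Σʷ (suc n) (F ∘ (_∷ʳ U)) ℕ.+ Σʷ (suc n) (F ∘ (_∷ʳ H)) ℕ.+ Σʷ (suc n) (F ∘ (_∷ʳ D))
    ∎
  where
  open ≡-Reasoning
  open ℕ-Solver.+-*-Solver
  g : Letter → Letter → ℕ
  g x y = Σʷ n (λ w → F (x ∷ (w ∷ʳ y)))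

does≡ : ∀ {A : Set} {b} (A? : Dec A) → A ⇔ T b → does A? ≡ b
does≡ {b = true}  A? A⇔T = dec-true A? (Equivalence.from A⇔T tt)
does≡ {b = false} A? A⇔T = dec-false A? (Equivalence.to A⇔T)

count≡Σʷ-accepts : ∀ n j → count n j ≡ Σʷ n (λ w → 𝟙 (accepts j (run start w)))
count≡Σʷ-accepts n j = trans (length-filter (inM? j) (words n)) (sum-map-cong (cong 𝟙 ∘ inM≡accepts) (words n))
  where
  inM≡accepts : ∀ w → does (inM? j w) ≡ accepts j (run start w)
  inM≡accepts w = does≡ (inM? j w) (⇔.trans (InM⇔ValidFrom-start j w) (ValidFrom⇔accepts 0 H j w))

isAt : Letter → ℕ → State → Bool
isAt l j dead        = false
isAt l j (live k l′) = does (l′ ≟L l) ∧ (k ≡ᵇ j)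

accepts-split : ∀ j σ → 𝟙 (accepts j σ) ≡ 𝟙 (isAt U j σ) ℕ.+ 𝟙 (isAt H j σ) ℕ.+ 𝟙 (isAt D j σ)
accepts-split j dead       = refl
accepts-split j (live k U) = sym (trans (ℕP.+-identityʳ _) (ℕP.+-identityʳ _))
accepts-split j (live k H) = sym (ℕP.+-identityʳ _)
accepts-split j (live k D) = refl

predecessors : Letter → ℕ → List (Letter × ℕ)
predecessors U zero    = []
predecessors U (suc j) = (H , j) ∷ (D , j) ∷ []
predecessors H j       = (U , j) ∷ (H , j) ∷ (D , j) ∷ []
predecessors D j       = (U , suc j) ∷ (H , suc j) ∷ []

arrivals : State → Letter → ℕ → ℕ
arrivals τ l j = 𝟙 (isAt l j (step τ U)) ℕ.+ 𝟙 (isAt l j (step τ H)) ℕ.+ 𝟙 (isAt l j (step τ D))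

arrivals≡Σ-predecessors : ∀ τ l j → arrivals τ l j ≡ sum (map (λ (l′ , j′) → 𝟙 (isAt l′ j′ τ)) (predecessors l j))
arrivals≡Σ-predecessors dead             U zero    = refl
arrivals≡Σ-predecessors dead             U (suc j) = refl
arrivals≡Σ-predecessors dead             H j       = refl
arrivals≡Σ-predecessors dead             D j       = refl
arrivals≡Σ-predecessors (live zero U)    U zero    = refl
arrivals≡Σ-predecessors (live (suc k) U) U zero    = refl
arrivals≡Σ-predecessors (live zero H)    U zero    = refl
arrivals≡Σ-predecessors (live (suc k) H) U zero    = refl
arrivals≡Σ-predecessors (live k D)       U zero    = refl
arrivals≡Σ-predecessors (live zero U)    U (suc j) = refl
arrivals≡Σ-predecessors (live (suc k) U) U (suc j) = refl
arrivals≡Σ-predecessors (live zero H)    U (suc j) = ℕP.+-identityʳ _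
arrivals≡Σ-predecessors (live (suc k) H) U (suc j) = ℕP.+-identityʳ _
arrivals≡Σ-predecessors (live k D)       U (suc j) = ℕP.+-identityʳ _
arrivals≡Σ-predecessors (live zero U)    H j       = refl
arrivals≡Σ-predecessors (live (suc k) U) H j       = refl
arrivals≡Σ-predecessors (live zero H)    H j       = refl
arrivals≡Σ-predecessors (live (suc k) H) H j       = refl
arrivals≡Σ-predecessors (live k D)       H j       = refl
arrivals≡Σ-predecessors (live zero U)    D j       = refl
arrivals≡Σ-predecessors (live (suc k) U) D j       = sym (ℕP.+-identityʳ _)
arrivals≡Σ-predecessors (live zero H)    D j       = refl
arrivals≡Σ-predecessors (live (suc k) H) D j       = sym (ℕP.+-identityʳ _)
arrivals≡Σ-predecessors (live k D)       D j       = refl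

reach : ℕ → Letter → ℕ → ℕ
reach n l j = Σʷ n (λ w → 𝟙 (isAt l j (run start w)))

count≡Σ-reach : ∀ n j → count n j ≡ reach n U j ℕ.+ reach n H j ℕ.+ reach n D j
count≡Σ-reach n j = begin
  count n j                                                ≡⟨ count≡Σʷ-accepts n j ⟩
  Σʷ n (λ w → 𝟙 (accepts j (run start w)))                 ≡⟨ sum-map-cong (accepts-split j ∘ run start) (words n) ⟩
  Σʷ n (λ w → at U w ℕ.+ at H w ℕ.+ at D w)                ≡⟨ sum-map-+ (λ w → at U w ℕ.+ at H w) (at D) (words n) ⟩
  Σʷ n (λ w → at U w ℕ.+ at H w) ℕ.+ reach n D j           ≡⟨ cong (ℕ._+ reach n D j) (sum-map-+ (at U) (at H) (words n)) ⟩
  reach n U j ℕ.+ reach n H j ℕ.+ reach n D j              ∎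
  where
  open ≡-Reasoning
  at : Letter → List Letter → ℕ
  at l w = 𝟙 (isAt l j (run start w))

reach-suc : ∀ n l j → reach (suc n) l j ≡ sum (map (λ (l′ , j′) → reach n l′ j′) (predecessors l j))
reach-suc n l j = begin
  reach (suc n) l j
    ≡⟨ Σʷ-append n (at l j) ⟩
  Σʷ n (at l j ∘ (_∷ʳ U)) ℕ.+ Σʷ n (at l j ∘ (_∷ʳ H)) ℕ.+ Σʷ n (at l j ∘ (_∷ʳ D))
    ≡⟨ cong₂ ℕ._+_ (cong₂ ℕ._+_ (last-step U) (last-step H)) (last-step D) ⟩
  Σʷ n (after U) ℕ.+ Σʷ n (after H) ℕ.+ Σʷ n (after D)
    ≡⟨ sym (trans (sum-map-+ (λ w → after U w ℕ.+ after H w) (after D) (words n))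
                  (cong (ℕ._+ Σʷ n (after D)) (sum-map-+ (after U) (after H) (words n)))) ⟩
  Σʷ n (λ w → arrivals (run start w) l j)
    ≡⟨ sum-map-cong (λ w → arrivals≡Σ-predecessors (run start w) l j) (words n) ⟩
  Σʷ n (λ w → sum (map (λ (l′ , j′) → at l′ j′ w) (predecessors l j)))
    ≡⟨ sum-map-sum (λ w (l′ , j′) → at l′ j′ w) (predecessors l j) (words n) ⟩
  sum (map (λ (l′ , j′) → reach n l′ j′) (predecessors l j))
    ∎
  where
  open ≡-Reasoning
  at : Letter → ℕ → List Letter → ℕ
  at l j w = 𝟙 (isAt l j (run start w))
  after : Letter → List Letter → ℕ
  after x w = 𝟙 (isAt l j (step (run start w) x))
  last-step : ∀ x → Σʷ n (at l j ∘ (_∷ʳ x)) ≡ Σʷ n (after x)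
  last-step x = sum-map-cong (λ w → cong (𝟙 ∘ isAt l j) (foldl-∷ʳ step start x w)) (words n)

-- The ring of formal power series

tail : PS → PS
tail f n = f (suc n)

-- Defined as const 0ℚ so that it is literally the solver's constant 0.
0ᴾ : PS
0ᴾ = const 0ℚ

-ᴾ_ : PS → PS
(-ᴾ f) n = ℚ.- f n

_·_ : ℚ → PS → PS
(c · f) n = c ℚ.* f n

⊛-zeroth : ∀ f g → (f ⊛ g) 0 ≡ f 0 ℚ.* g 0
⊛-zeroth f g = ℚP.+-identityʳ _

⊛-suc : ∀ f g n → (f ⊛ g) (suc n) ≡ f 0 ℚ.* g (suc n) ℚ.+ (tail f ⊛ g) n
⊛-suc f g n = cong (f 0 ℚ.* g (suc n) ℚ.+_)
  (trans (cong (foldr term 0ℚ) (sym (map-upTo suc (suc n)))) (foldr-map term suc 0ℚ (upTo (suc n))))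
  where
  term : ℕ → ℚ → ℚ
  term i s = f i ℚ.* g (suc n ∸ i) ℚ.+ s

⊛-sucʳ : ∀ f g n → (f ⊛ g) (suc n) ≡ (f ⊛ tail g) n ℚ.+ f (suc n) ℚ.* g 0
⊛-sucʳ f g zero = begin
  (f ⊛ g) 1                          ≡⟨ ⊛-suc f g 0 ⟩
  f 0 ℚ.* g 1 ℚ.+ (tail f ⊛ g) 0     ≡⟨ cong₂ ℚ._+_ (sym (⊛-zeroth f (tail g))) (⊛-zeroth (tail f) g) ⟩
  (f ⊛ tail g) 0 ℚ.+ f 1 ℚ.* g 0     ∎
  where open ≡-Reasoning
⊛-sucʳ f g (suc n) = begin
  (f ⊛ g) (suc (suc n))
    ≡⟨ ⊛-suc f g (suc n) ⟩
  a ℚ.+ (tail f ⊛ g) (suc n)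
    ≡⟨ cong (a ℚ.+_) (⊛-sucʳ (tail f) g n) ⟩
  a ℚ.+ ((tail f ⊛ tail g) n ℚ.+ b)
    ≡⟨ sym (ℚP.+-assoc a _ b) ⟩
  (a ℚ.+ (tail f ⊛ tail g) n) ℚ.+ b
    ≡⟨ cong (ℚ._+ b) (sym (⊛-suc f (tail g) n)) ⟩
  (f ⊛ tail g) (suc n) ℚ.+ b
    ∎
  where
  open ≡-Reasoning
  a = f 0 ℚ.* g (suc (suc n))
  b = f (suc (suc n)) ℚ.* g 0

⊛-cong : ∀ {f f′ g g′} → f ≈ f′ → g ≈ g′ → f ⊛ g ≈ f′ ⊛ g′
⊛-cong {f} {f′} {g} {g′} f≈f′ g≈g′ zero = begin
  (f ⊛ g) 0        ≡⟨ ⊛-zeroth f g ⟩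
  f 0 ℚ.* g 0      ≡⟨ cong₂ ℚ._*_ (f≈f′ 0) (g≈g′ 0) ⟩
  f′ 0 ℚ.* g′ 0    ≡⟨ sym (⊛-zeroth f′ g′) ⟩
  (f′ ⊛ g′) 0      ∎
  where open ≡-Reasoning
⊛-cong {f} {f′} {g} {g′} f≈f′ g≈g′ (suc n) = begin
  (f ⊛ g) (suc n)                          ≡⟨ ⊛-suc f g n ⟩
  f 0 ℚ.* g (suc n) ℚ.+ (tail f ⊛ g) n     ≡⟨ cong₂ ℚ._+_ (cong₂ ℚ._*_ (f≈f′ 0) (g≈g′ (suc n)))
                                                         (⊛-cong (f≈f′ ∘ suc) g≈g′ n) ⟩
  f′ 0 ℚ.* g′ (suc n) ℚ.+ (tail f′ ⊛ g′) n  ≡⟨ sym (⊛-suc f′ g′ n) ⟩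
  (f′ ⊛ g′) (suc n)                        ∎
  where open ≡-Reasoning

⊛-comm : ∀ f g → f ⊛ g ≈ g ⊛ f
⊛-comm f g zero = begin
  (f ⊛ g) 0    ≡⟨ ⊛-zeroth f g ⟩
  f 0 ℚ.* g 0  ≡⟨ ℚP.*-comm (f 0) (g 0) ⟩
  g 0 ℚ.* f 0  ≡⟨ sym (⊛-zeroth g f) ⟩
  (g ⊛ f) 0    ∎
  where open ≡-Reasoning
⊛-comm f g (suc n) = begin
  (f ⊛ g) (suc n)                          ≡⟨ ⊛-suc f g n ⟩
  f 0 ℚ.* g (suc n) ℚ.+ (tail f ⊛ g) n     ≡⟨ cong₂ ℚ._+_ (ℚP.*-comm (f 0) (g (suc n))) (⊛-comm (tail f) g n) ⟩
  g (suc n) ℚ.* f 0 ℚ.+ (g ⊛ tail f) n     ≡⟨ ℚP.+-comm _ ((g ⊛ tail f) n) ⟩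
  (g ⊛ tail f) n ℚ.+ g (suc n) ℚ.* f 0     ≡⟨ sym (⊛-sucʳ g f n) ⟩
  (g ⊛ f) (suc n)                          ∎
  where open ≡-Reasoning

vanishing-⊛ : ∀ f g → (∀ n → f n ≡ 0ℚ) → ∀ n → (f ⊛ g) n ≡ 0ℚ
vanishing-⊛ f g f≡0 zero = begin
  (f ⊛ g) 0    ≡⟨ ⊛-zeroth f g ⟩
  f 0 ℚ.* g 0  ≡⟨ cong (ℚ._* g 0) (f≡0 0) ⟩
  0ℚ ℚ.* g 0   ≡⟨ ℚP.*-zeroˡ (g 0) ⟩
  0ℚ           ∎
  where open ≡-Reasoning
vanishing-⊛ f g f≡0 (suc n) = begin
  (f ⊛ g) (suc n)                          ≡⟨ ⊛-suc f g n ⟩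
  f 0 ℚ.* g (suc n) ℚ.+ (tail f ⊛ g) n     ≡⟨ cong₂ ℚ._+_ (cong (ℚ._* g (suc n)) (f≡0 0))
                                                         (vanishing-⊛ (tail f) g (f≡0 ∘ suc) n) ⟩
  0ℚ ℚ.* g (suc n) ℚ.+ 0ℚ                  ≡⟨ cong (ℚ._+ 0ℚ) (ℚP.*-zeroˡ (g (suc n))) ⟩
  0ℚ                                       ∎
  where open ≡-Reasoning

0ᴾ-at : ∀ n → 0ᴾ n ≡ 0ℚ
0ᴾ-at zero    = refl
0ᴾ-at (suc n) = refl

const-⊛ : ∀ c f → const c ⊛ f ≈ c · f
const-⊛ c f zero    = ⊛-zeroth (const c) f
const-⊛ c f (suc n) = begin
  (const c ⊛ f) (suc n)                          ≡⟨ ⊛-suc (const c) f n ⟩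
  c ℚ.* f (suc n) ℚ.+ (tail (const c) ⊛ f) n     ≡⟨ cong (c ℚ.* f (suc n) ℚ.+_) (vanishing-⊛ _ f (λ _ → refl) n) ⟩
  c ℚ.* f (suc n) ℚ.+ 0ℚ                         ≡⟨ ℚP.+-identityʳ _ ⟩
  c ℚ.* f (suc n)                                ∎
  where open ≡-Reasoning

·-⊛ : ∀ c f g → (c · f) ⊛ g ≈ c · (f ⊛ g)
·-⊛ c f g zero = begin
  ((c · f) ⊛ g) 0              ≡⟨ ⊛-zeroth (c · f) g ⟩
  c ℚ.* f 0 ℚ.* g 0            ≡⟨ ℚP.*-assoc c (f 0) (g 0) ⟩
  c ℚ.* (f 0 ℚ.* g 0)          ≡⟨ cong (c ℚ.*_) (sym (⊛-zeroth f g)) ⟩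
  c ℚ.* (f ⊛ g) 0              ∎
  where open ≡-Reasoning
·-⊛ c f g (suc n) = begin
  ((c · f) ⊛ g) (suc n)                        ≡⟨ ⊛-suc (c · f) g n ⟩
  c ℚ.* f 0 ℚ.* g (suc n) ℚ.+ ((c · tail f) ⊛ g) n
                                               ≡⟨ cong (c ℚ.* f 0 ℚ.* g (suc n) ℚ.+_) (·-⊛ c (tail f) g n) ⟩
  c ℚ.* f 0 ℚ.* g (suc n) ℚ.+ c ℚ.* (tail f ⊛ g) n
                                               ≡⟨ solve 4 (λ c a b d → c :* a :* b :+ c :* d := c :* (a :* b :+ d))
                                                          refl c (f 0) (g (suc n)) _ ⟩
  c ℚ.* (f 0 ℚ.* g (suc n) ℚ.+ (tail f ⊛ g) n) ≡⟨ cong (c ℚ.*_) (sym (⊛-suc f g n)) ⟩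
  c ℚ.* (f ⊛ g) (suc n)                        ∎
  where
  open ≡-Reasoning
  open ℚ-Solver.+-*-Solver

⊛-distribʳ : ∀ f g h → (f ⊕ g) ⊛ h ≈ f ⊛ h ⊕ g ⊛ h
⊛-distribʳ f g h zero = begin
  ((f ⊕ g) ⊛ h) 0                ≡⟨ ⊛-zeroth (f ⊕ g) h ⟩
  (f 0 ℚ.+ g 0) ℚ.* h 0          ≡⟨ ℚP.*-distribʳ-+ (h 0) (f 0) (g 0) ⟩
  f 0 ℚ.* h 0 ℚ.+ g 0 ℚ.* h 0    ≡⟨ sym (cong₂ ℚ._+_ (⊛-zeroth f h) (⊛-zeroth g h)) ⟩
  (f ⊛ h ⊕ g ⊛ h) 0              ∎
  where open ≡-Reasoning
⊛-distribʳ f g h (suc n) = begin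
  ((f ⊕ g) ⊛ h) (suc n)
    ≡⟨ ⊛-suc (f ⊕ g) h n ⟩
  (f 0 ℚ.+ g 0) ℚ.* h (suc n) ℚ.+ ((tail f ⊕ tail g) ⊛ h) n
    ≡⟨ cong ((f 0 ℚ.+ g 0) ℚ.* h (suc n) ℚ.+_) (⊛-distribʳ (tail f) (tail g) h n) ⟩
  (f 0 ℚ.+ g 0) ℚ.* h (suc n) ℚ.+ ((tail f ⊛ h) n ℚ.+ (tail g ⊛ h) n)
    ≡⟨ solve 5 (λ a b c d e → (a :+ b) :* c :+ (d :+ e) := (a :* c :+ d) :+ (b :* c :+ e))
             refl (f 0) (g 0) (h (suc n)) _ _ ⟩
  (f 0 ℚ.* h (suc n) ℚ.+ (tail f ⊛ h) n) ℚ.+ (g 0 ℚ.* h (suc n) ℚ.+ (tail g ⊛ h) n)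
    ≡⟨ sym (cong₂ ℚ._+_ (⊛-suc f h n) (⊛-suc g h n)) ⟩
  (f ⊛ h ⊕ g ⊛ h) (suc n)
    ∎
  where
  open ≡-Reasoning
  open ℚ-Solver.+-*-Solver

⊛-distribˡ : ∀ f g h → f ⊛ (g ⊕ h) ≈ f ⊛ g ⊕ f ⊛ h
⊛-distribˡ f g h n = begin
  (f ⊛ (g ⊕ h)) n          ≡⟨ ⊛-comm f (g ⊕ h) n ⟩
  ((g ⊕ h) ⊛ f) n          ≡⟨ ⊛-distribʳ g h f n ⟩
  (g ⊛ f ⊕ h ⊛ f) n        ≡⟨ cong₂ ℚ._+_ (⊛-comm g f n) (⊛-comm h f n) ⟩
  (f ⊛ g ⊕ f ⊛ h) n        ∎
  where open ≡-Reasoning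

⊛-assoc : ∀ f g h → (f ⊛ g) ⊛ h ≈ f ⊛ (g ⊛ h)
⊛-assoc f g h zero = begin
  ((f ⊛ g) ⊛ h) 0          ≡⟨ ⊛-zeroth (f ⊛ g) h ⟩
  (f ⊛ g) 0 ℚ.* h 0        ≡⟨ cong (ℚ._* h 0) (⊛-zeroth f g) ⟩
  f 0 ℚ.* g 0 ℚ.* h 0      ≡⟨ ℚP.*-assoc (f 0) (g 0) (h 0) ⟩
  f 0 ℚ.* (g 0 ℚ.* h 0)    ≡⟨ cong (f 0 ℚ.*_) (sym (⊛-zeroth g h)) ⟩
  f 0 ℚ.* (g ⊛ h) 0        ≡⟨ sym (⊛-zeroth f (g ⊛ h)) ⟩
  (f ⊛ (g ⊛ h)) 0          ∎
  where open ≡-Reasoning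
⊛-assoc f g h (suc n) = begin
  ((f ⊛ g) ⊛ h) (suc n)
    ≡⟨ ⊛-suc (f ⊛ g) h n ⟩
  (f ⊛ g) 0 ℚ.* h (suc n) ℚ.+ (tail (f ⊛ g) ⊛ h) n
    ≡⟨ cong₂ ℚ._+_ (cong (ℚ._* h (suc n)) (⊛-zeroth f g)) (⊛-cong {g = h} (⊛-suc f g) (λ _ → refl) n) ⟩
  f 0 ℚ.* g 0 ℚ.* h (suc n) ℚ.+ ((f 0 · tail g ⊕ tail f ⊛ g) ⊛ h) n
    ≡⟨ cong (f 0 ℚ.* g 0 ℚ.* h (suc n) ℚ.+_) (⊛-distribʳ (f 0 · tail g) (tail f ⊛ g) h n) ⟩
  f 0 ℚ.* g 0 ℚ.* h (suc n) ℚ.+ (((f 0 · tail g) ⊛ h) n ℚ.+ ((tail f ⊛ g) ⊛ h) n)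
    ≡⟨ cong (f 0 ℚ.* g 0 ℚ.* h (suc n) ℚ.+_) (cong₂ ℚ._+_ (·-⊛ (f 0) (tail g) h n) (⊛-assoc (tail f) g h n)) ⟩
  f 0 ℚ.* g 0 ℚ.* h (suc n) ℚ.+ (f 0 ℚ.* (tail g ⊛ h) n ℚ.+ (tail f ⊛ (g ⊛ h)) n)
    ≡⟨ solve 5 (λ a b c d e → a :* b :* c :+ (a :* d :+ e) := a :* (b :* c :+ d) :+ e)
             refl (f 0) (g 0) (h (suc n)) _ _ ⟩
  f 0 ℚ.* (g 0 ℚ.* h (suc n) ℚ.+ (tail g ⊛ h) n) ℚ.+ (tail f ⊛ (g ⊛ h)) n
    ≡⟨ cong (λ x → f 0 ℚ.* x ℚ.+ (tail f ⊛ (g ⊛ h)) n) (sym (⊛-suc g h n)) ⟩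
  f 0 ℚ.* (g ⊛ h) (suc n) ℚ.+ (tail f ⊛ (g ⊛ h)) n
    ≡⟨ sym (⊛-suc f (g ⊛ h) n) ⟩
  (f ⊛ (g ⊛ h)) (suc n)
    ∎
  where
  open ≡-Reasoning
  open ℚ-Solver.+-*-Solver

one-⊛ : ∀ f → one ⊛ f ≈ f
one-⊛ f n = trans (const-⊛ 1ℚ f n) (ℚP.*-identityˡ (f n))

PS-isCommutativeRing : IsCommutativeRing _⊕_ _⊛_ -ᴾ_ 0ᴾ one
PS-isCommutativeRing = record
  { isRing = record
    { +-isAbelianGroup = record
      { isGroup = record
        { isMonoid = record
          { isSemigroup = record
            { isMagma = record
              { isEquivalence = record { refl = λ _ → refl ; sym = λ p n → sym (p n) ; trans = λ p q n → trans (p n) (q n) }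
              ; ∙-cong = λ p q n → cong₂ ℚ._+_ (p n) (q n) }
            ; assoc = λ f g h n → ℚP.+-assoc (f n) (g n) (h n) }
          ; identity = (λ f n → trans (cong (ℚ._+ f n) (0ᴾ-at n)) (ℚP.+-identityˡ (f n)))
                     , (λ f n → trans (cong (f n ℚ.+_) (0ᴾ-at n)) (ℚP.+-identityʳ (f n))) }
        ; inverse = (λ f n → trans (ℚP.+-inverseˡ (f n)) (sym (0ᴾ-at n)))
                  , (λ f n → trans (ℚP.+-inverseʳ (f n)) (sym (0ᴾ-at n)))
        ; ⁻¹-cong = λ p n → cong ℚ.-_ (p n) }
      ; comm = λ f g n → ℚP.+-comm (f n) (g n) }
    ; *-cong = ⊛-cong
    ; *-assoc = ⊛-assoc
    ; *-identity = one-⊛ , (λ f n → trans (⊛-comm f one n) (one-⊛ f n))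
    ; distrib = ⊛-distribˡ , (λ f g h → ⊛-distribʳ g h f) }
  ; *-comm = ⊛-comm }

PS-commutativeRing : CommutativeRing 0ℓ 0ℓ
PS-commutativeRing = record { isCommutativeRing = PS-isCommutativeRing }

PS-almostCommutativeRing : AlmostCommutativeRing 0ℓ 0ℓ
PS-almostCommutativeRing = fromCommutativeRing PS-commutativeRing

const-homomorphism : ℚP.+-*-rawRing -Raw-AlmostCommutative⟶ PS-almostCommutativeRing
const-homomorphism = record
  { ⟦_⟧    = const
  ; +-homo = λ { a b zero → refl ; a b (suc n) → sym (ℚP.+-identityˡ 0ℚ) }
  ; *-homo = λ a b n → sym (trans (const-⊛ a (const b) n) (const-* a b n))
  ; -‿homo = λ { a zero → refl ; a (suc n) → refl }
  ; 0-homo = λ _ → refl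
  ; 1-homo = λ _ → refl }
  where
  const-* : ∀ a b n → a ℚ.* const b n ≡ const (a ℚ.* b) n
  const-* a b zero    = refl
  const-* a b (suc n) = ℚP.*-zeroʳ a

const-≟ : ∀ a b → Maybe (const a ≈ const b)
const-≟ a b with a ℚP.≟ b
... | yes refl = just (λ _ → refl)
... | no _     = nothing

module PS-Solver = Algebra.Solver.Ring ℚP.+-*-rawRing PS-almostCommutativeRing const-homomorphism const-≟
module PS = CommutativeRing PS-commutativeRing

-- Identities that hold only modulo a ≈ b are reduced to ring identities with an explicit cofactor k.
≈-modulo : ∀ {x y a b} k → x ≈ y ⊕ k ⊛ (a ⊖ b) → a ≈ b → x ≈ y
≈-modulo {x} {y} {a} {b} k x≈ a≈b = begin
  x                       ≈⟨ x≈ ⟩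
  y ⊕ k ⊛ (a ⊖ b)         ≈⟨ PS.+-congˡ {y} (PS.*-congˡ {k} (PS.+-congʳ { -ᴾ b} a≈b)) ⟩
  y ⊕ k ⊛ (b ⊕ -ᴾ b)      ≈⟨ PS.+-congˡ {y} (PS.*-congˡ {k} (PS.-‿inverseʳ b)) ⟩
  y ⊕ k ⊛ 0ᴾ              ≈⟨ PS.+-congˡ {y} (PS.zeroʳ k) ⟩
  y ⊕ 0ᴾ                  ≈⟨ PS.+-identityʳ y ⟩
  y                       ∎
  where open ≈-Reasoning PS.setoid

≈-modulo₂ : ∀ {x y a₁ b₁ a₂ b₂} k₁ k₂ → x ≈ y ⊕ k₁ ⊛ (a₁ ⊖ b₁) ⊕ k₂ ⊛ (a₂ ⊖ b₂) → a₁ ≈ b₁ → a₂ ≈ b₂ → x ≈ y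
≈-modulo₂ k₁ k₂ x≈ a₁≈b₁ a₂≈b₂ = ≈-modulo k₁ (≈-modulo k₂ x≈ a₂≈b₂) a₁≈b₁

Z⊛-zeroth : ∀ f → (Z ⊛ f) 0 ≡ 0ℚ
Z⊛-zeroth f = trans (⊛-zeroth Z f) (ℚP.*-zeroˡ (f 0))

Z⊛-suc : ∀ f n → (Z ⊛ f) (suc n) ≡ f n
Z⊛-suc f n = begin
  (Z ⊛ f) (suc n)                        ≡⟨ ⊛-suc Z f n ⟩
  0ℚ ℚ.* f (suc n) ℚ.+ (tail Z ⊛ f) n    ≡⟨ cong₂ ℚ._+_ (ℚP.*-zeroˡ (f (suc n))) (⊛-cong {g = f} tail-Z≈one (λ _ → refl) n) ⟩
  0ℚ ℚ.+ (one ⊛ f) n                     ≡⟨ ℚP.+-identityˡ _ ⟩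
  (one ⊛ f) n                            ≡⟨ one-⊛ f n ⟩
  f n                                    ∎
  where
  open ≡-Reasoning
  tail-Z≈one : tail Z ≈ one
  tail-Z≈one zero    = refl
  tail-Z≈one (suc n) = refl

Z⊛-cancel : ∀ {f g} → Z ⊛ f ≈ Z ⊛ g → f ≈ g
Z⊛-cancel {f} {g} Zf≈Zg n = trans (sym (Z⊛-suc f n)) (trans (Zf≈Zg (suc n)) (Z⊛-suc g n))

Z⊛-tail : ∀ f → f 0 ≡ 0ℚ → f ≈ Z ⊛ tail f
Z⊛-tail f f₀≡0 zero    = trans f₀≡0 (sym (Z⊛-zeroth (tail f)))
Z⊛-tail f f₀≡0 (suc n) = sym (Z⊛-suc (tail f) n)

open PS-Solver using (solve; _:=_; _:+_; _:*_; _:-_; :-_; _:^_; con)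

Z²⊛≈Z⊛Z⊛ : ∀ f → Z ^ᶠ 2 ⊛ f ≈ Z ⊛ (Z ⊛ f)
Z²⊛≈Z⊛Z⊛ = solve 2 (λ z f → z :^ 2 :* f := z :* (z :* f)) (λ _ → refl) Z

Z²⊛-cancel : ∀ {f g} → Z ^ᶠ 2 ⊛ f ≈ Z ^ᶠ 2 ⊛ g → f ≈ g
Z²⊛-cancel {f} {g} Z²f≈Z²g =
  Z⊛-cancel (Z⊛-cancel (PS.trans (PS.sym (Z²⊛≈Z⊛Z⊛ f)) (PS.trans Z²f≈Z²g (Z²⊛≈Z⊛Z⊛ g))))

Z²⊛-tail² : ∀ f → f 0 ≡ 0ℚ → f 1 ≡ 0ℚ → f ≈ Z ^ᶠ 2 ⊛ tail (tail f)
Z²⊛-tail² f f₀≡0 f₁≡0 = begin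
  f                           ≈⟨ Z⊛-tail f f₀≡0 ⟩
  Z ⊛ tail f                  ≈⟨ PS.*-congˡ {Z} (Z⊛-tail (tail f) f₁≡0) ⟩
  Z ⊛ (Z ⊛ tail (tail f))     ≈⟨ PS.sym (Z²⊛≈Z⊛Z⊛ (tail (tail f))) ⟩
  Z ^ᶠ 2 ⊛ tail (tail f)      ∎
  where open ≈-Reasoning PS.setoid

-- The kernel equation

P₃ : PS
P₃ = one ⊖ Z ⊖ Z ^ᶠ 2 ⊖ Z ^ᶠ 3

-- s = r / z², and s-fixed is the kernel equation z² r² − (1 − z − z² − z³) r + z² = 0 divided by z².
record Kernel (r : PS) : Set where
  field
    s       : PS
    r≈Z²s   : r ≈ Z ^ᶠ 2 ⊛ s
    s-fixed : s ≈ one ⊕ Z ⊛ s ⊕ r ⊕ Z ⊛ r ⊕ r ⊛ r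

quarter : ℚ
quarter = + 1 ℚ./ 4

r₁-kernel-equation : ∀ {W r} → IsW W → IsR1 W r → Z ^ᶠ 2 ⊛ (one ⊕ r ⊛ r) ⊖ P₃ ⊛ r ≈ 0ᴾ
r₁-kernel-equation {W} {r} (_ , W²≈Wsq) 2Z²r≈P₃-W = Z²⊛-cancel (≈-modulo₂ k₁ k₂ identity W²≈Wsq 2Z²r≈P₃-W)
  where
  k₁ k₂ : PS
  k₁ = const quarter
  k₂ = -ᴾ (const quarter ⊛ (P₃ ⊖ two ⊛ Z ^ᶠ 2 ⊛ r ⊕ W))
  -- As P₃² − Wsq = 4 z⁴, we have (P₃ − 2 z² r)² − Wsq = 4 z² (z² (1 + r²) − P₃ r).
  identity : Z ^ᶠ 2 ⊛ (Z ^ᶠ 2 ⊛ (one ⊕ r ⊛ r) ⊖ P₃ ⊛ r)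
           ≈ Z ^ᶠ 2 ⊛ 0ᴾ ⊕ k₁ ⊛ (W ⊛ W ⊖ Wsq) ⊕ k₂ ⊛ (two ⊛ Z ^ᶠ 2 ⊛ r ⊖ (P₃ ⊖ W))
  identity = solve 3 (λ z r w →
    let o = con 1ℚ ; t = con (fromℕℚ 2) ; p₃ = o :- z :- z :^ 2 :- z :^ 3 in
    z :^ 2 :* (z :^ 2 :* (o :+ r :* r) :- p₃ :* r)
      := z :^ 2 :* con 0ℚ
         :+ con quarter :* (w :* w :- (o :- z :^ 4) :* (o :- t :* z :- z :^ 2))
         :+ :- (con quarter :* (p₃ :- t :* z :^ 2 :* r :+ w)) :* (t :* z :^ 2 :* r :- (p₃ :- w)))
    (λ _ → refl) Z r W

kernel-of-r₁ : ∀ {W r} → IsW W → IsR1 W r → Kernel r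
kernel-of-r₁ {W} {r} isW isR1 = record { s = tail (tail r) ; r≈Z²s = r≈Z²s ; s-fixed = Z²⊛-cancel Z²s≈ }
  where
  kernel-equation : Z ^ᶠ 2 ⊛ (one ⊕ r ⊛ r) ⊖ P₃ ⊛ r ≈ 0ᴾ
  kernel-equation = r₁-kernel-equation {W} {r} isW isR1
  r/z : PS
  r/z = Z ⊛ (one ⊕ r ⊛ r) ⊕ (one ⊕ Z ⊕ Z ^ᶠ 2) ⊛ r
  r≈Z⊛r/z : r ≈ Z ⊛ r/z
  r≈Z⊛r/z = ≈-modulo (-ᴾ one)
    (solve 2 (λ z r → let o = con 1ℚ ; p₃ = o :- z :- z :^ 2 :- z :^ 3 in
      r := z :* (z :* (o :+ r :* r) :+ (o :+ z :+ z :^ 2) :* r) :+ :- o :* (z :^ 2 :* (o :+ r :* r) :- p₃ :* r :- con 0ℚ))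
      (λ _ → refl) Z r)
    kernel-equation
  r₀≡0 : r 0 ≡ 0ℚ
  r₀≡0 = trans (r≈Z⊛r/z 0) (Z⊛-zeroth r/z)
  r₁≡0 : r 1 ≡ 0ℚ
  r₁≡0 = begin
    r 1                                             ≡⟨ r≈Z⊛r/z 1 ⟩
    (Z ⊛ r/z) 1                                     ≡⟨ Z⊛-suc r/z 0 ⟩
    (Z ⊛ (one ⊕ r ⊛ r)) 0 ℚ.+ ((one ⊕ Z ⊕ Z ^ᶠ 2) ⊛ r) 0
                                                    ≡⟨ cong₂ ℚ._+_ (Z⊛-zeroth (one ⊕ r ⊛ r)) (⊛-zeroth (one ⊕ Z ⊕ Z ^ᶠ 2) r) ⟩
    0ℚ ℚ.+ (one ⊕ Z ⊕ Z ^ᶠ 2) 0 ℚ.* r 0             ≡⟨ cong (λ c → 0ℚ ℚ.+ (one ⊕ Z ⊕ Z ^ᶠ 2) 0 ℚ.* c) r₀≡0 ⟩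
    0ℚ ℚ.+ (one ⊕ Z ⊕ Z ^ᶠ 2) 0 ℚ.* 0ℚ              ≡⟨⟩
    0ℚ                                              ∎
    where open ≡-Reasoning
  r≈Z²s : r ≈ Z ^ᶠ 2 ⊛ tail (tail r)
  r≈Z²s = Z²⊛-tail² r r₀≡0 r₁≡0
  Z²s≈ : Z ^ᶠ 2 ⊛ tail (tail r) ≈ Z ^ᶠ 2 ⊛ (one ⊕ Z ⊛ tail (tail r) ⊕ r ⊕ Z ⊛ r ⊕ r ⊛ r)
  Z²s≈ = ≈-modulo₂ (-ᴾ one) (Z ⊖ one)
    (solve 3 (λ z r s → let o = con 1ℚ ; p₃ = o :- z :- z :^ 2 :- z :^ 3 in
      z :^ 2 :* s := z :^ 2 :* (o :+ z :* s :+ r :+ z :* r :+ r :* r)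
                     :+ :- o :* (z :^ 2 :* (o :+ r :* r) :- p₃ :* r :- con 0ℚ)
                     :+ (z :- o) :* (r :- z :^ 2 :* s))
      (λ _ → refl) Z r (tail (tail r)))
    kernel-equation r≈Z²s

-- Existence of r₁

infix 4 _≈[<_]_
_≈[<_]_ : PS → ℕ → PS → Set
f ≈[< n ] g = ∀ m → m < n → f m ≡ g m

≈[<]-pred : ∀ {n f g} → f ≈[< suc n ] g → f ≈[< n ] g
≈[<]-pred f≈g m m<n = f≈g m (ℕP.m<n⇒m<1+n m<n)

≈[<]-⊕ : ∀ {n f f′ g g′} → f ≈[< n ] f′ → g ≈[< n ] g′ → f ⊕ g ≈[< n ] f′ ⊕ g′
≈[<]-⊕ f≈f′ g≈g′ m m<n = cong₂ ℚ._+_ (f≈f′ m m<n) (g≈g′ m m<n)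

⊛-coefficient-local : ∀ m {f f′ g g′} → f ≈[< suc m ] f′ → g ≈[< suc m ] g′ → (f ⊛ g) m ≡ (f′ ⊛ g′) m
⊛-coefficient-local zero {f} {f′} {g} {g′} f≈f′ g≈g′ = begin
  (f ⊛ g) 0        ≡⟨ ⊛-zeroth f g ⟩
  f 0 ℚ.* g 0      ≡⟨ cong₂ ℚ._*_ (f≈f′ 0 (s≤s z≤n)) (g≈g′ 0 (s≤s z≤n)) ⟩
  f′ 0 ℚ.* g′ 0    ≡⟨ sym (⊛-zeroth f′ g′) ⟩
  (f′ ⊛ g′) 0      ∎
  where open ≡-Reasoning
⊛-coefficient-local (suc m) {f} {f′} {g} {g′} f≈f′ g≈g′ = begin
  (f ⊛ g) (suc m)                          ≡⟨ ⊛-suc f g m ⟩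
  f 0 ℚ.* g (suc m) ℚ.+ (tail f ⊛ g) m     ≡⟨ cong₂ ℚ._+_ (cong₂ ℚ._*_ (f≈f′ 0 (s≤s z≤n)) (g≈g′ (suc m) ℕP.≤-refl))
                                                          (⊛-coefficient-local m (λ i i<1+m → f≈f′ (suc i) (s≤s i<1+m))
                                                                                 (≈[<]-pred g≈g′)) ⟩
  f′ 0 ℚ.* g′ (suc m) ℚ.+ (tail f′ ⊛ g′) m  ≡⟨ sym (⊛-suc f′ g′ m) ⟩
  (f′ ⊛ g′) (suc m)                        ∎
  where open ≡-Reasoning

≈[<]-⊛ : ∀ {n f f′ g g′} → f ≈[< n ] f′ → g ≈[< n ] g′ → f ⊛ g ≈[< n ] f′ ⊛ g′
≈[<]-⊛ f≈f′ g≈g′ m m<n = ⊛-coefficient-local m (below f≈f′) (below g≈g′)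
  where
  below : ∀ {f g} → f ≈[< _ ] g → f ≈[< suc m ] g
  below f≈g i i<1+m = f≈g i (ℕP.<-≤-trans i<1+m m<n)

≈[<]-Z⊛ : ∀ {n f g} → f ≈[< n ] g → Z ⊛ f ≈[< suc n ] Z ⊛ g
≈[<]-Z⊛ {n} {f} {g} f≈g zero    _         = trans (Z⊛-zeroth f) (sym (Z⊛-zeroth g))
≈[<]-Z⊛ {n} {f} {g} f≈g (suc m) (s≤s m<n) = trans (Z⊛-suc f m) (trans (f≈g m m<n) (sym (Z⊛-suc g m)))

Contractive : (PS → PS) → Set
Contractive Φ = ∀ {n f g} → f ≈[< n ] g → Φ f ≈[< suc n ] Φ g

contractive⇒fixed-point : ∀ Φ → Contractive Φ → Σ PS λ s → Φ s ≈ s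
contractive⇒fixed-point Φ contractive = s , Φs≈s
  where
  approx : ℕ → PS
  approx zero    = 0ᴾ
  approx (suc k) = Φ (approx k)
  approx-step : ∀ k → approx k ≈[< k ] approx (suc k)
  approx-step zero    m ()
  approx-step (suc k) = contractive (approx-step k)
  approx-stable : ∀ k m → m < k → approx k m ≡ approx (suc m) m
  approx-stable (suc k) m m<1+k with ℕP.m<1+n⇒m<n∨m≡n m<1+k
  ... | inj₁ m<k  = trans (sym (approx-step k m m<k)) (approx-stable k m m<k)
  ... | inj₂ refl = refl
  s : PS
  s n = approx (suc n) n
  Φs≈s : Φ s ≈ s
  Φs≈s n = contractive (λ m m<n → sym (approx-stable n m m<n)) n ℕP.≤-refl

kernelMap : PS → PS
kernelMap s = one ⊕ Z ⊛ (s ⊕ Z ⊛ (s ⊕ Z ⊛ (s ⊕ Z ⊛ (s ⊛ s))))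

kernelMap-contractive : Contractive kernelMap
kernelMap-contractive f≈g =
  ≈[<]-⊕ {f = one} (λ _ _ → refl) (horner f≈g (horner f≈g (horner f≈g (≈[<]-Z⊛ (≈[<]-⊛ f≈g f≈g)))))
  where
  horner : ∀ {n f g x y} → f ≈[< n ] g → x ≈[< suc n ] y → Z ⊛ (f ⊕ x) ≈[< suc n ] Z ⊛ (g ⊕ y)
  horner f≈g x≈y = ≈[<]-Z⊛ (≈[<]-⊕ f≈g (≈[<]-pred x≈y))

kernel-of-fixed-point : ∀ {s} → kernelMap s ≈ s → Kernel (Z ^ᶠ 2 ⊛ s)
kernel-of-fixed-point {s} fixed = record { s = s ; r≈Z²s = PS.refl ; s-fixed = PS.trans (PS.sym fixed) expand }
  where
  expand : kernelMap s ≈ one ⊕ Z ⊛ s ⊕ Z ^ᶠ 2 ⊛ s ⊕ Z ⊛ (Z ^ᶠ 2 ⊛ s) ⊕ Z ^ᶠ 2 ⊛ s ⊛ (Z ^ᶠ 2 ⊛ s)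
  expand = solve 2 (λ z s →
    let o = con 1ℚ in
    o :+ z :* (s :+ z :* (s :+ z :* (s :+ z :* (s :* s))))
      := o :+ z :* s :+ z :^ 2 :* s :+ z :* (z :^ 2 :* s) :+ z :^ 2 :* s :* (z :^ 2 :* s))
    (λ _ → refl) Z s

kernel-exists : Σ PS Kernel
kernel-exists =
  let s , fixed = contractive⇒fixed-point kernelMap kernelMap-contractive
  in Z ^ᶠ 2 ⊛ s , kernel-of-fixed-point fixed

W-of : PS → PS
W-of r = P₃ ⊖ two ⊛ Z ^ᶠ 2 ⊛ r

W-of-isR1 : ∀ r → IsR1 (W-of r) r
W-of-isR1 = solve 2 (λ z r →
  let o = con 1ℚ ; t = con (fromℕℚ 2) ; p₃ = o :- z :- z :^ 2 :- z :^ 3 in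
  t :* z :^ 2 :* r := p₃ :- (p₃ :- t :* z :^ 2 :* r))
  (λ _ → refl) Z

W-of-isW : ∀ {r} → Kernel r → IsW (W-of r)
W-of-isW {r} K = W₀≡1 , ≈-modulo₂ k₁ k₂ identity s-fixed r≈Z²s
  where
  open Kernel K
  r₀≡0 : r 0 ≡ 0ℚ
  r₀≡0 = trans (r≈Z²s 0) (trans (⊛-zeroth (Z ^ᶠ 2) s) (ℚP.*-zeroˡ (s 0)))
  W₀≡1 : W-of r 0 ≡ 1ℚ
  W₀≡1 = begin
    P₃ 0 ℚ.- (two ⊛ Z ^ᶠ 2 ⊛ r) 0            ≡⟨ cong (λ c → P₃ 0 ℚ.- c) (⊛-zeroth (two ⊛ Z ^ᶠ 2) r) ⟩
    P₃ 0 ℚ.- (two ⊛ Z ^ᶠ 2) 0 ℚ.* r 0        ≡⟨ cong (λ c → P₃ 0 ℚ.- (two ⊛ Z ^ᶠ 2) 0 ℚ.* c) r₀≡0 ⟩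
    P₃ 0 ℚ.- (two ⊛ Z ^ᶠ 2) 0 ℚ.* 0ℚ         ≡⟨⟩
    1ℚ                                       ∎
    where open ≡-Reasoning
  k₁ k₂ : PS
  k₁ = -ᴾ (const (fromℕℚ 4) ⊛ Z ^ᶠ 4)
  k₂ = -ᴾ (const (fromℕℚ 4) ⊛ Z ^ᶠ 2 ⊛ (one ⊖ Z))
  identity : W-of r ⊛ W-of r ≈ Wsq ⊕ k₁ ⊛ (s ⊖ (one ⊕ Z ⊛ s ⊕ r ⊕ Z ⊛ r ⊕ r ⊛ r)) ⊕ k₂ ⊛ (r ⊖ Z ^ᶠ 2 ⊛ s)
  identity = solve 3 (λ z r s →
    let o = con 1ℚ ; t = con (fromℕℚ 2) ; f = con (fromℕℚ 4) ; p₃ = o :- z :- z :^ 2 :- z :^ 3 ; w = p₃ :- t :* z :^ 2 :* r in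
    w :* w := (o :- z :^ 4) :* (o :- t :* z :- z :^ 2)
              :+ :- (f :* z :^ 4) :* (s :- (o :+ z :* s :+ r :+ z :* r :+ r :* r))
              :+ :- (f :* z :^ 2 :* (o :- z)) :* (r :- z :^ 2 :* s))
    (λ _ → refl) Z r s

r₁-exists : Σ PS λ W → Σ PS λ r₁ → IsW W × IsR1 W r₁
r₁-exists = let r , K = kernel-exists in W-of r , r , W-of-isW K , W-of-isR1 r

fromℕℚ-+ : ∀ a b → fromℕℚ (a ℕ.+ b) ≡ fromℕℚ a ℚ.+ fromℕℚ b
fromℕℚ-+ a b = sym (begin
  fromℕℚ a ℚ.+ fromℕℚ b                                  ≡⟨ cong₂ ℚ._+_ (as-mkℚ a) (as-mkℚ b) ⟩
  (+ a ℤ.* + 1 ℤ.+ + b ℤ.* + 1) ℚ./ 1                    ≡⟨ cong₂ (λ x y → (x ℤ.+ y) ℚ./ 1) (ℤP.*-identityʳ (+ a)) (ℤP.*-identityʳ (+ b)) ⟩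
  fromℕℚ (a ℕ.+ b)                                       ∎)
  where
  open ≡-Reasoning
  as-mkℚ : ∀ n → fromℕℚ n ≡ ℚ.mkℚ (+ n) 0 (Coprime.sym (Coprime.1-coprimeTo n))
  as-mkℚ n = ℚP.normalize-coprime (Coprime.sym (Coprime.1-coprimeTo n))

δ : Letter → ℕ → ℚ
δ H zero = 1ℚ
δ _ _    = 0ℚ

Σᴾ : List PS → PS
Σᴾ = foldr _⊕_ 0ᴾ

incoming : (Letter → ℕ → PS) → Letter → ℕ → PS
incoming F l j = Σᴾ (map (λ (l′ , j′) → F l′ j′) (predecessors l j))

Transfer : (Letter → ℕ → PS) → Set
Transfer F = ∀ l j → F l j ≈ const (δ l j) ⊕ Z ⊛ incoming F l j

module _ {A : Set} where

  Σᴾ-map-cong-at : ∀ {F G : A → PS} n → (∀ a → F a n ≡ G a n) → ∀ as → Σᴾ (map F as) n ≡ Σᴾ (map G as) n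
  Σᴾ-map-cong-at n F≡G []       = refl
  Σᴾ-map-cong-at n F≡G (a ∷ as) = cong₂ ℚ._+_ (F≡G a) (Σᴾ-map-cong-at n F≡G as)

  Σᴾ-map-fromℕℚ : ∀ (f : A → ℕ → ℕ) n as → Σᴾ (map (λ a m → fromℕℚ (f a m)) as) n ≡ fromℕℚ (sum (map (λ a → f a n) as))
  Σᴾ-map-fromℕℚ f n []       = 0ᴾ-at n
  Σᴾ-map-fromℕℚ f n (a ∷ as) =
    trans (cong (fromℕℚ (f a n) ℚ.+_) (Σᴾ-map-fromℕℚ f n as)) (sym (fromℕℚ-+ (f a n) (sum (map (λ a → f a n) as))))

transfer-unique : ∀ {F G} → Transfer F → Transfer G → ∀ l j → F l j ≈ G l j
transfer-unique {F} {G} F-transfer G-transfer l j n = coefficient n l j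
  where
  open ≡-Reasoning
  coefficient : ∀ n l j → F l j n ≡ G l j n
  coefficient zero l j = begin
    F l j 0                              ≡⟨ F-transfer l j 0 ⟩
    δ l j ℚ.+ (Z ⊛ incoming F l j) 0     ≡⟨ cong (δ l j ℚ.+_) (trans (Z⊛-zeroth (incoming F l j)) (sym (Z⊛-zeroth (incoming G l j)))) ⟩
    δ l j ℚ.+ (Z ⊛ incoming G l j) 0     ≡⟨ sym (G-transfer l j 0) ⟩
    G l j 0                              ∎
  coefficient (suc n) l j = begin
    F l j (suc n)                           ≡⟨ F-transfer l j (suc n) ⟩
    0ℚ ℚ.+ (Z ⊛ incoming F l j) (suc n)     ≡⟨ cong (0ℚ ℚ.+_) (Z⊛-suc (incoming F l j) n) ⟩
    0ℚ ℚ.+ incoming F l j n                 ≡⟨ cong (0ℚ ℚ.+_) (Σᴾ-map-cong-at n (λ (l′ , j′) → coefficient n l′ j′) (predecessors l j)) ⟩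
    0ℚ ℚ.+ incoming G l j n                 ≡⟨ cong (0ℚ ℚ.+_) (sym (Z⊛-suc (incoming G l j) n)) ⟩
    0ℚ ℚ.+ (Z ⊛ incoming G l j) (suc n)     ≡⟨ sym (G-transfer l j (suc n)) ⟩
    G l j (suc n)                           ∎

reachGF : Letter → ℕ → PS
reachGF l j n = fromℕℚ (reach n l j)

reachGF-transfer : Transfer reachGF
reachGF-transfer l j zero = begin
  fromℕℚ (reach 0 l j)                        ≡⟨ initially l j ⟩
  δ l j                                       ≡⟨ sym (ℚP.+-identityʳ (δ l j)) ⟩
  δ l j ℚ.+ 0ℚ                                ≡⟨ cong (δ l j ℚ.+_) (sym (Z⊛-zeroth (incoming reachGF l j))) ⟩
  δ l j ℚ.+ (Z ⊛ incoming reachGF l j) 0      ∎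
  where
  open ≡-Reasoning
  initially : ∀ l j → fromℕℚ (reach 0 l j) ≡ δ l j
  initially U j       = refl
  initially H zero    = refl
  initially H (suc j) = refl
  initially D j       = refl
reachGF-transfer l j (suc n) = begin
  fromℕℚ (reach (suc n) l j)                                        ≡⟨ cong fromℕℚ (reach-suc n l j) ⟩
  fromℕℚ (sum (map (λ (l′ , j′) → reach n l′ j′) (predecessors l j))) ≡⟨ sym (Σᴾ-map-fromℕℚ (λ (l′ , j′) m → reach m l′ j′) n (predecessors l j)) ⟩
  incoming reachGF l j n                                            ≡⟨ sym (ℚP.+-identityˡ _) ⟩
  0ℚ ℚ.+ incoming reachGF l j n                                     ≡⟨ cong (0ℚ ℚ.+_) (sym (Z⊛-suc (incoming reachGF l j) n)) ⟩
  0ℚ ℚ.+ (Z ⊛ incoming reachGF l j) (suc n)                         ∎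
  where open ≡-Reasoning

S≈Σ-reachGF : ∀ j → S j ≈ reachGF U j ⊕ reachGF H j ⊕ reachGF D j
S≈Σ-reachGF j n = begin
  fromℕℚ (count n j)                                             ≡⟨ cong fromℕℚ (count≡Σ-reach n j) ⟩
  fromℕℚ (reach n U j ℕ.+ reach n H j ℕ.+ reach n D j)           ≡⟨ fromℕℚ-+ (reach n U j ℕ.+ reach n H j) (reach n D j) ⟩
  fromℕℚ (reach n U j ℕ.+ reach n H j) ℚ.+ reachGF D j n         ≡⟨ cong (ℚ._+ reachGF D j n) (fromℕℚ-+ (reach n U j) (reach n H j)) ⟩
  reachGF U j n ℚ.+ reachGF H j n ℚ.+ reachGF D j n              ∎
  where open ≡-Reasoning

⊛B-zeroth : ∀ F G → (F ⊛B G) 0 ≈ F 0 ⊛ G 0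
⊛B-zeroth F G n = ℚP.+-identityʳ _

⊛B-suc : ∀ F G j → (F ⊛B G) (suc j) ≈ F 0 ⊛ G (suc j) ⊕ ((F ∘ suc) ⊛B G) j
⊛B-suc F G j n = cong ((F 0 ⊛ G (suc j)) n ℚ.+_)
  (trans (cong (foldr term 0ℚ) (sym (map-upTo suc (suc j)))) (foldr-map term suc 0ℚ (upTo (suc j))))
  where
  term : ℕ → ℚ → ℚ
  term i s = (F i ⊛ G (suc j ∸ i)) n ℚ.+ s

ι-suc : ∀ f j → ι f (suc j) ≈ 0ᴾ
ι-suc f j n = sym (0ᴾ-at n)

⊛B-ιʳ : ∀ F g j → (F ⊛B ι g) j ≈ F j ⊛ g
⊛B-ιʳ F g zero    = ⊛B-zeroth F (ι g)
⊛B-ιʳ F g (suc j) = begin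
  (F ⊛B ι g) (suc j)                             ≈⟨ ⊛B-suc F (ι g) j ⟩
  F 0 ⊛ ι g (suc j) ⊕ ((F ∘ suc) ⊛B ι g) j       ≈⟨ PS.+-cong (PS.trans (PS.*-congˡ {F 0} (ι-suc g j)) (PS.zeroʳ (F 0))) (⊛B-ιʳ (F ∘ suc) g j) ⟩
  0ᴾ ⊕ F (suc j) ⊛ g                             ≈⟨ PS.+-identityˡ _ ⟩
  F (suc j) ⊛ g                                  ∎
  where open ≈-Reasoning PS.setoid

zero-⊛B : ∀ G j → ((λ _ _ → 0ℚ) ⊛B G) j ≈ 0ᴾ
zero-⊛B G zero    = PS.trans (⊛B-zeroth (λ _ _ → 0ℚ) G) (PS.trans (PS.*-congʳ {G 0} (ι-suc one 0)) (PS.zeroˡ (G 0)))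
zero-⊛B G (suc j) = begin
  ((λ _ _ → 0ℚ) ⊛B G) (suc j)                     ≈⟨ ⊛B-suc (λ _ _ → 0ℚ) G j ⟩
  (λ _ → 0ℚ) ⊛ G (suc j) ⊕ ((λ _ _ → 0ℚ) ⊛B G) j  ≈⟨ PS.+-cong (PS.trans (PS.*-congʳ {G (suc j)} (ι-suc one 0)) (PS.zeroˡ (G (suc j)))) (zero-⊛B G j) ⟩
  0ᴾ ⊕ 0ᴾ                                         ≈⟨ PS.+-identityˡ 0ᴾ ⟩
  0ᴾ                                              ∎
  where open ≈-Reasoning PS.setoid

⊛B-ιˡ : ∀ f G j → (ι f ⊛B G) j ≈ f ⊛ G j
⊛B-ιˡ f G zero    = ⊛B-zeroth (ι f) G
⊛B-ιˡ f G (suc j) = begin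
  (ι f ⊛B G) (suc j)                             ≈⟨ ⊛B-suc (ι f) G j ⟩
  f ⊛ G (suc j) ⊕ ((ι f ∘ suc) ⊛B G) j           ≈⟨ PS.+-congˡ {f ⊛ G (suc j)} (zero-⊛B G j) ⟩
  f ⊛ G (suc j) ⊕ 0ᴾ                             ≈⟨ PS.+-identityʳ _ ⟩
  f ⊛ G (suc j)                                  ∎
  where open ≈-Reasoning PS.setoid

record Linearᵘ (F : BS) (a b : PS) : Set where
  field
    coeff₀  : F 0 ≈ a
    coeff₁  : F 1 ≈ b
    coeff₂₊ : ∀ k → F (suc (suc k)) ≈ 0ᴾ
open Linearᵘ

ι-linear : ∀ f → Linearᵘ (ι f) f 0ᴾ
ι-linear f = record { coeff₀ = PS.refl ; coeff₁ = ι-suc f 0 ; coeff₂₊ = ι-suc f ∘ suc }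

Uv-linear : Linearᵘ Uv 0ᴾ one
Uv-linear = record { coeff₀ = ι-suc one 0 ; coeff₁ = PS.refl ; coeff₂₊ = λ k → ι-suc one (suc k) }

⊕B-linear : ∀ {F G a b c d} → Linearᵘ F a b → Linearᵘ G c d → Linearᵘ (F ⊕B G) (a ⊕ c) (b ⊕ d)
⊕B-linear F≈ G≈ = record
  { coeff₀  = PS.+-cong (coeff₀ F≈) (coeff₀ G≈)
  ; coeff₁  = PS.+-cong (coeff₁ F≈) (coeff₁ G≈)
  ; coeff₂₊ = λ k → PS.trans (PS.+-cong (coeff₂₊ F≈ k) (coeff₂₊ G≈ k)) (PS.+-identityˡ 0ᴾ) }

⊖B-linear : ∀ {F G a b c d} → Linearᵘ F a b → Linearᵘ G c d → Linearᵘ (F ⊖B G) (a ⊖ c) (b ⊖ d)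
⊖B-linear F≈ G≈ = record
  { coeff₀  = PS.+-cong (coeff₀ F≈) (PS.-‿cong (coeff₀ G≈))
  ; coeff₁  = PS.+-cong (coeff₁ F≈) (PS.-‿cong (coeff₁ G≈))
  ; coeff₂₊ = λ k → PS.trans (PS.+-cong (coeff₂₊ F≈ k) (PS.-‿cong (coeff₂₊ G≈ k))) (PS.-‿inverseʳ 0ᴾ) }

ι⊛B-linear : ∀ f {G a b} → Linearᵘ G a b → Linearᵘ (ι f ⊛B G) (f ⊛ a) (f ⊛ b)
ι⊛B-linear f {G} G≈ = record
  { coeff₀  = PS.trans (⊛B-ιˡ f G 0) (PS.*-congˡ {f} (coeff₀ G≈))
  ; coeff₁  = PS.trans (⊛B-ιˡ f G 1) (PS.*-congˡ {f} (coeff₁ G≈))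
  ; coeff₂₊ = λ k → PS.trans (⊛B-ιˡ f G (suc (suc k))) (PS.trans (PS.*-congˡ {f} (coeff₂₊ G≈ k)) (PS.zeroʳ f)) }

⊛Bι-linear : ∀ {F a b} g → Linearᵘ F a b → Linearᵘ (F ⊛B ι g) (a ⊛ g) (b ⊛ g)
⊛Bι-linear {F} g F≈ = record
  { coeff₀  = PS.trans (⊛B-ιʳ F g 0) (PS.*-congʳ {g} (coeff₀ F≈))
  ; coeff₁  = PS.trans (⊛B-ιʳ F g 1) (PS.*-congʳ {g} (coeff₁ F≈))
  ; coeff₂₊ = λ k → PS.trans (⊛B-ιʳ F g (suc (suc k))) (PS.trans (PS.*-congʳ {g} (coeff₂₊ F≈ k)) (PS.zeroˡ g)) }

⊛B-linear-zero : ∀ F {G a b} → Linearᵘ G a b → (F ⊛B G) 0 ≈ F 0 ⊛ a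
⊛B-linear-zero F {G} G≈ = PS.trans (⊛B-zeroth F G) (PS.*-congˡ {F 0} (coeff₀ G≈))

⊛B-linear-suc : ∀ F {G a b} → Linearᵘ G a b → ∀ j → (F ⊛B G) (suc j) ≈ F (suc j) ⊛ a ⊕ F j ⊛ b
⊛B-linear-suc F {G} {a} {b} G≈ zero = begin
  (F ⊛B G) 1                       ≈⟨ ⊛B-suc F G 0 ⟩
  F 0 ⊛ G 1 ⊕ ((F ∘ suc) ⊛B G) 0   ≈⟨ PS.+-cong (PS.*-congˡ {F 0} (coeff₁ G≈)) (⊛B-linear-zero (F ∘ suc) G≈) ⟩
  F 0 ⊛ b ⊕ F 1 ⊛ a                ≈⟨ PS.+-comm (F 0 ⊛ b) (F 1 ⊛ a) ⟩
  F 1 ⊛ a ⊕ F 0 ⊛ b                ∎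
  where open ≈-Reasoning PS.setoid
⊛B-linear-suc F {G} {a} {b} G≈ (suc j) = begin
  (F ⊛B G) (suc (suc j))                          ≈⟨ ⊛B-suc F G (suc j) ⟩
  F 0 ⊛ G (suc (suc j)) ⊕ ((F ∘ suc) ⊛B G) (suc j) ≈⟨ PS.+-cong (PS.trans (PS.*-congˡ {F 0} (coeff₂₊ G≈ j)) (PS.zeroʳ (F 0)))
                                                                (⊛B-linear-suc (F ∘ suc) G≈ j) ⟩
  0ᴾ ⊕ (F (suc (suc j)) ⊛ a ⊕ F (suc j) ⊛ b)      ≈⟨ PS.+-identityˡ _ ⟩
  F (suc (suc j)) ⊛ a ⊕ F (suc j) ⊛ b             ∎
  where open ≈-Reasoning PS.setoid

-- The closed forms

module _ {r : PS} (K : Kernel r) where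
  open Kernel K

  stateGF : Letter → ℕ → PS
  stateGF U zero    = 0ᴾ
  stateGF U (suc j) = Z ⊛ s ⊛ r ^ᶠ j
  stateGF H j       = r ^ᶠ j ⊛ (one ⊕ Z ⊛ s)
  stateGF D j       = r ^ᶠ suc j ⊛ (one ⊕ Z ⊕ r)

  stateGF-transfer : Transfer stateGF
  stateGF-transfer U zero = solve 1 (λ z → con 0ℚ := con 0ℚ :+ z :* con 0ℚ) (λ _ → refl) Z
  stateGF-transfer U (suc j) = ≈-modulo (Z ⊛ r ^ᶠ j)
    (solve 4 (λ z r s q → let o = con 1ℚ in
      z :* s :* q := con 0ℚ :+ z :* (q :* (o :+ z :* s) :+ (r :* q :* (o :+ z :+ r) :+ con 0ℚ))
                     :+ z :* q :* (s :- (o :+ z :* s :+ r :+ z :* r :+ r :* r)))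
      (λ _ → refl) Z r s (r ^ᶠ j))
    s-fixed
  stateGF-transfer H zero = ≈-modulo Z
    (solve 3 (λ z r s → let o = con 1ℚ in
      o :* (o :+ z :* s) := o :+ z :* (con 0ℚ :+ (o :* (o :+ z :* s) :+ (r :* o :* (o :+ z :+ r) :+ con 0ℚ)))
                            :+ z :* (s :- (o :+ z :* s :+ r :+ z :* r :+ r :* r)))
      (λ _ → refl) Z r s)
    s-fixed
  stateGF-transfer H (suc j) = ≈-modulo₂ (Z ⊛ r ⊛ r ^ᶠ j) (r ^ᶠ j)
    (solve 4 (λ z r s q → let o = con 1ℚ in
      r :* q :* (o :+ z :* s)
        := con 0ℚ :+ z :* (z :* s :* q :+ (r :* q :* (o :+ z :* s) :+ (r :* (r :* q) :* (o :+ z :+ r) :+ con 0ℚ)))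
           :+ z :* r :* q :* (s :- (o :+ z :* s :+ r :+ z :* r :+ r :* r))
           :+ q :* (r :- z :^ 2 :* s))
      (λ _ → refl) Z r s (r ^ᶠ j))
    s-fixed r≈Z²s
  stateGF-transfer D j = ≈-modulo (r ^ᶠ j ⊕ r ^ᶠ suc j)
    (solve 4 (λ z r s q → let o = con 1ℚ in
      r :* q :* (o :+ z :+ r)
        := con 0ℚ :+ z :* (z :* s :* q :+ (r :* q :* (o :+ z :* s) :+ con 0ℚ))
           :+ (q :+ r :* q) :* (r :- z :^ 2 :* s))
      (λ _ → refl) Z r s (r ^ᶠ j))
    r≈Z²s

  S≈Σ-stateGF : ∀ j → S j ≈ stateGF U j ⊕ stateGF H j ⊕ stateGF D j
  S≈Σ-stateGF j = PS.trans (S≈Σ-reachGF j) (PS.+-cong (PS.+-cong (reach≈state U) (reach≈state H)) (reach≈state D))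
    where
    reach≈state : ∀ l → reachGF l j ≈ stateGF l j
    reach≈state l = transfer-unique reachGF-transfer stateGF-transfer l j

  levelGF : ℕ → PS
  levelGF zero    = r
  levelGF (suc j) = r ^ᶠ suc (suc j) ⊕ Z ⊛ r ^ᶠ suc j

  Z²⊛S≈levelGF : ∀ j → Z ^ᶠ 2 ⊛ S j ≈ levelGF j
  Z²⊛S≈levelGF j = PS.trans (PS.*-congˡ {Z ^ᶠ 2} (S≈Σ-stateGF j)) (Z²⊛Σ-stateGF j)
    where
    Z²⊛Σ-stateGF : ∀ j → Z ^ᶠ 2 ⊛ (stateGF U j ⊕ stateGF H j ⊕ stateGF D j) ≈ levelGF j
    Z²⊛Σ-stateGF zero = ≈-modulo₂ (-ᴾ (Z ^ᶠ 2)) (-ᴾ one)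
      (solve 3 (λ z r s → let o = con 1ℚ in
        z :^ 2 :* (con 0ℚ :+ o :* (o :+ z :* s) :+ r :* o :* (o :+ z :+ r))
          := r :+ :- z :^ 2 :* (s :- (o :+ z :* s :+ r :+ z :* r :+ r :* r)) :+ :- o :* (r :- z :^ 2 :* s))
        (λ _ → refl) Z r s)
      s-fixed r≈Z²s
    Z²⊛Σ-stateGF (suc j) = ≈-modulo₂ (-ᴾ (Z ^ᶠ 2 ⊛ r ⊛ r ^ᶠ j)) (-ᴾ (Z ⊛ r ^ᶠ j ⊕ r ⊛ r ^ᶠ j))
      (solve 4 (λ z r s q → let o = con 1ℚ in
        z :^ 2 :* (z :* s :* q :+ r :* q :* (o :+ z :* s) :+ r :* (r :* q) :* (o :+ z :+ r))
          := r :* (r :* q) :+ z :* (r :* q)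
             :+ :- (z :^ 2 :* r :* q) :* (s :- (o :+ z :* s :+ r :+ z :* r :+ r :* r))
             :+ :- (z :* q :+ r :* q) :* (r :- z :^ 2 :* s))
        (λ _ → refl) Z r s (r ^ᶠ j))
      s-fixed r≈Z²s

  denominator-linear : Linearᵘ (ι (Z ^ᶠ 2) ⊛B (ι one ⊖B Uv ⊛B ι r)) (Z ^ᶠ 2 ⊛ (one ⊖ 0ᴾ ⊛ r)) (Z ^ᶠ 2 ⊛ (0ᴾ ⊖ one ⊛ r))
  denominator-linear = ι⊛B-linear (Z ^ᶠ 2) (⊖B-linear (ι-linear one) (⊛Bι-linear r Uv-linear))

  numerator-linear : Linearᵘ ((ι one ⊕B ι Z ⊛B Uv) ⊛B ι r) ((one ⊕ Z ⊛ 0ᴾ) ⊛ r) ((0ᴾ ⊕ Z ⊛ one) ⊛ r)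
  numerator-linear = ⊛Bι-linear r (⊕B-linear (ι-linear one) (ι⊛B-linear Z Uv-linear))

  S-functional-equation : S ⊛B (ι (Z ^ᶠ 2) ⊛B (ι one ⊖B Uv ⊛B ι r)) ≈B (ι one ⊕B ι Z ⊛B Uv) ⊛B ι r
  S-functional-equation zero = PS.trans (⊛B-linear-zero S denominator-linear)
    (PS.trans (≈-modulo one
      (solve 3 (λ z r s₀ → let o = con 1ℚ in
        s₀ :* (z :^ 2 :* (o :- con 0ℚ :* r)) := (o :+ z :* con 0ℚ) :* r :+ o :* (z :^ 2 :* s₀ :- r))
        (λ _ → refl) Z r (S 0))
      (Z²⊛S≈levelGF 0))
    (PS.sym (coeff₀ numerator-linear)))
  S-functional-equation (suc zero) = PS.trans (⊛B-linear-suc S denominator-linear 0)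
    (PS.trans (≈-modulo₂ one (-ᴾ r)
      (solve 4 (λ z r s₀ s₁ → let o = con 1ℚ in
        s₁ :* (z :^ 2 :* (o :- con 0ℚ :* r)) :+ s₀ :* (z :^ 2 :* (con 0ℚ :- o :* r))
          := (con 0ℚ :+ z :* o) :* r :+ o :* (z :^ 2 :* s₁ :- (r :* (r :* o) :+ z :* (r :* o))) :+ :- r :* (z :^ 2 :* s₀ :- r))
        (λ _ → refl) Z r (S 0) (S 1))
      (Z²⊛S≈levelGF 1) (Z²⊛S≈levelGF 0))
    (PS.sym (coeff₁ numerator-linear)))
  S-functional-equation (suc (suc k)) = PS.trans (⊛B-linear-suc S denominator-linear (suc k))
    (PS.trans (≈-modulo₂ one (-ᴾ r)
      (solve 5 (λ z r s₁ s₂ q → let o = con 1ℚ in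
        s₂ :* (z :^ 2 :* (o :- con 0ℚ :* r)) :+ s₁ :* (z :^ 2 :* (con 0ℚ :- o :* r))
          := con 0ℚ :+ o :* (z :^ 2 :* s₂ :- (r :* (r :* (r :* q)) :+ z :* (r :* (r :* q))))
                    :+ :- r :* (z :^ 2 :* s₁ :- (r :* (r :* q) :+ z :* (r :* q))))
        (λ _ → refl) Z r (S (suc k)) (S (suc (suc k))) (r ^ᶠ k))
      (Z²⊛S≈levelGF (suc (suc k))) (Z²⊛S≈levelGF (suc k)))
    (PS.sym (coeff₂₊ numerator-linear k)))

mainTheorem10 : (Σ PS λ W → Σ PS λ r₁ → IsW W × IsR1 W r₁)
    × ((W r₁ : PS) → IsW W → IsR1 W r₁ →
    (S ⊛B (ι (Z ^ᶠ 2) ⊛B (ι one ⊖B Uv ⊛B ι r₁)) ≈B (ι one ⊕B ι Z ⊛B Uv) ⊛B ι r₁)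
    × ((j : ℕ) → j ≥ 1 → Z ^ᶠ 2 ⊛ S j ≈ r₁ ^ᶠ (suc j) ⊕ Z ⊛ r₁ ^ᶠ j))
mainTheorem10 = r₁-exists , λ W r₁ isW isR1 →
  let K = kernel-of-r₁ isW isR1
  in S-functional-equation K , λ { (suc j) _ → Z²⊛S≈levelGF K (suc j) }
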